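{- For all integers $m\ge1$ and $n\ge1$, there exists a universal cycle for the word patterns of length $n$ over the alphabet $[m]$: letting $N$ be the number of patterns of length $n$ over $[m]$, there is a sequence $a_0a_1\ldots a_{N-1}$ of letters of $[m]$ such that, with indices taken modulo $N$, the words $a_{i+1}a_{i+2}\ldots a_{i+n}$ for $0\le i<N$ run through each pattern of length $n$ over $[m]$ exactly once.
   Context: Let $[m]=\{1,\ldots,m\}$ with its natural order. A pattern is a nonempty word which, for some $k\ge1$, contains each of the letters $1,\ldots,k$ at least once and no other letters. -}

module Defs where

open import Data.Nat using (ℕ; _+_; _≤_; _<_; NonZero)
open import Data.Nat.DivMod using (_%_)
open import Data.List using (List; []; map; upTo; length)
open import Data.List.Relation.Unary.All using (All)
open import Data.List.Membership.Propositional using (_∈_)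
open import Data.Product using (_×_; ∃-syntax)
open import Relation.Binary.PropositionalEquality using (_≡_; _≢_)

InAlphabet : ℕ → ℕ → Set
InAlphabet m x = 1 ≤ x × x ≤ m

IsPattern : List ℕ → Set
IsPattern w =
  w ≢ [] ×
  ∃[ k ] (1 ≤ k × All (λ x → 1 ≤ x × x ≤ k) w × (∀ x → 1 ≤ x → x ≤ k → x ∈ w))

PatternOver : ℕ → ℕ → List ℕ → Set
PatternOver m n w = length w ≡ n × All (InAlphabet m) w × IsPattern w

-- The cyclic window a_{i+1} a_{i+2} … a_{i+n}, indices taken modulo N
-- (the sequence a_0 … a_{N-1} is given as a function ℕ → ℕ; only the
-- values at 0,…,N-1 are ever used).
window : (N : ℕ) .{{_ : NonZero N}} → (ℕ → ℕ) → ℕ → ℕ → List ℕ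
window N a n i = map (λ j → a ((i + 1 + j) % N)) (upTo n)

{-# OPTIONS --safe #-}
-- Write w ↝ w′ when w′ is w shifted by one letter (drop the first letter,
-- append a new last one).  Rotations of a pattern are patterns, so every
-- rotation class of patterns is a closed ↝-walk.  Start from the cycle of 1ⁿ
-- and repeatedly splice in the rotation class of a missing pattern e that has
-- the same tail as some word t on the cycle: e and t have the same
-- ↝-successors, so the class fits between t and its successor.  When no such
-- e is left, every pattern is on the cycle, by induction on the letter sum:
-- replacing an occurrence of the largest letter k ≥ 2 by 1 gives a pattern,
-- and after rotating that position to the front the two words have the same
-- tail.  The first letters along this Hamiltonian cycle form the universal
-- cycle.
module Submission where

open import Defs
open import Data.Nat
  using (ℕ; zero; suc; pred; _+_; _*_; _∸_; _≤_; _<_; z≤n; s≤s; s≤s⁻¹; NonZero; _≟_; _≤?_)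
open import Data.Nat.Properties
  using (≤-refl; ≤-trans; ≤-reflexive; <⇒≤; +-comm; +-suc; m≤n+m; m≤n⇒m≤1+n; m<n⇒m<1+n;
         m≤n⇒m<n∨m≡n; m+[n∸m]≡n; m≤n⇒∃[o]m+o≡n; ≤∧≢⇒<; 1+n≰n; +-monoˡ-<)
open import Data.Nat.DivMod
  using (_%_; _/_; m%n<n; m%n%n≡m%n; [m+n]%n≡m%n; [m+kn]%n≡m%n; m≡m%n+[m/n]*n; %-distribˡ-+;
         m≤n⇒m%n≡m; n%n≡0)
open import Data.Nat.Induction using (<-wellFounded)
open import Data.Nat.ListAction using (sum)
open import Data.Nat.ListAction.Properties using (sum-↭)
open import Data.List
  using (List; []; _∷_; _++_; [_]; map; length; upTo; applyUpTo; take; drop; replicate;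
         cartesianProductWith)
open import Data.List.Properties
  using (++-assoc; ++-identityʳ; ++-conicalʳ; ∷ʳ-injective; take-all; map-cong; map-upTo;
         applyUpTo-∷ʳ; length-replicate; ≡-dec)
open import Data.List.Relation.Unary.All as All using (All; []; _∷_; all?)
import Data.List.Relation.Unary.All.Properties as Allₚ
open import Data.List.Relation.Unary.AllPairs using ([]; _∷_)
open import Data.List.Relation.Unary.Any using (Any; here; there; any?; satisfied)
open import Data.List.Relation.Unary.Linked using (Linked; []; [-]; _∷_)
import Data.List.Relation.Unary.Linked.Properties as Linkedₚ
open import Data.List.Relation.Unary.Unique.Propositional using (Unique)
import Data.List.Relation.Unary.Unique.Propositional.Properties as Uniqueₚ
open import Data.List.Relation.Binary.Disjoint.Propositional using (Disjoint)
open import Data.List.Relation.Binary.Subset.Propositional using (_⊆_)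
open import Data.List.Relation.Binary.Permutation.Propositional
  using (_↭_; ↭-refl; ↭-sym; ↭-trans; ↭-reflexive; ↭⇒↭ₛ; module PermutationReasoning)
open import Data.List.Relation.Binary.Permutation.Propositional.Properties
  using (∈-resp-↭; All-resp-↭; ↭-length; ↭-empty-inv; ∷↭∷ʳ; shifts; ++-comm)
import Data.List.Relation.Binary.Permutation.Setoid.Properties as Permutationₛ
open import Data.List.Membership.Propositional using (_∈_; _∉_; find; lose)
open import Data.List.Membership.Propositional.Properties
  using (∈-++⁺ˡ; ∈-++⁺ʳ; ∈-++⁻; ∈-∃++; ∈-applyUpTo⁺; ∈-applyUpTo⁻; ∈-cartesianProductWith⁺)
import Data.List.Membership.DecPropositional as DecMembership
open import Data.Product using (Σ; _×_; _,_; proj₁; proj₂; ∃-syntax)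
open import Data.Sum using (inj₁; inj₂)
open import Function using (_∘_)
open import Induction.WellFounded using (Acc; acc)
open import Relation.Binary using (DecidableEquality)
open import Relation.Binary.PropositionalEquality
  using (_≡_; _≢_; refl; sym; trans; cong; cong₂; subst; setoid; module ≡-Reasoning)
open import Relation.Nullary using (¬_; Dec; yes; no; contradiction)
open import Relation.Nullary.Decidable using (_×-dec_; ¬?; map′; decidable-stable)
open import Relation.Unary using (Decidable)

private
  variable
    A : Set
    R : A → A → Set
    x e t : A
    xs ys zs : List A
    i j k m n : ℕ

-- Rotations and shifts

rotate : List A → List A
rotate []       = []
rotate (x ∷ xs) = xs ++ [ x ]

rotate^ : ℕ → List A → List A
rotate^ zero    xs = xs
rotate^ (suc k) xs = rotate^ k (rotate xs)

↭-rotate : (xs : List A) → rotate xs ↭ xs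
↭-rotate []       = ↭-refl
↭-rotate (x ∷ xs) = ↭-sym (∷↭∷ʳ x xs)

↭-rotate^ : ∀ k (xs : List A) → rotate^ k xs ↭ xs
↭-rotate^ zero    xs = ↭-refl
↭-rotate^ (suc k) xs = ↭-trans (↭-rotate^ k (rotate xs)) (↭-rotate xs)

rotate^-≢[] : ∀ k → xs ≢ [] → rotate^ k xs ≢ []
rotate^-≢[] {xs = xs} k xs≢[] eq =
  xs≢[] (↭-empty-inv (↭-trans (↭-sym (↭-rotate^ k xs)) (↭-reflexive eq)))

rotate-injective : (xs ys : List A) → rotate xs ≡ rotate ys → xs ≡ ys
rotate-injective []       []       _  = refl
rotate-injective []       (y ∷ ys) eq = contradiction (++-conicalʳ ys [ y ] (sym eq)) λ ()
rotate-injective (x ∷ xs) []       eq = contradiction (++-conicalʳ xs [ x ] eq) λ ()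
rotate-injective (x ∷ xs) (y ∷ ys) eq with refl , refl ← ∷ʳ-injective xs ys eq = refl

rotate^-injective : ∀ k → rotate^ k xs ≡ rotate^ k ys → xs ≡ ys
rotate^-injective zero    eq = eq
rotate^-injective (suc k) eq = rotate-injective _ _ (rotate^-injective k eq)

rotate^-+ : ∀ i j (xs : List A) → rotate^ (i + j) xs ≡ rotate^ j (rotate^ i xs)
rotate^-+ zero    j xs = refl
rotate^-+ (suc i) j xs = rotate^-+ i j (rotate xs)

rotate^-suc : ∀ k (xs : List A) → rotate^ (suc k) xs ≡ rotate (rotate^ k xs)
rotate^-suc k xs = trans (cong (λ i → rotate^ i xs) (+-comm 1 k)) (rotate^-+ k 1 xs)

rotate^-++ : (xs ys : List A) → rotate^ (length xs) (xs ++ ys) ≡ ys ++ xs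
rotate^-++ []       ys = sym (++-identityʳ ys)
rotate^-++ (x ∷ xs) ys = begin
  rotate^ (length xs) ((xs ++ ys) ++ [ x ]) ≡⟨ cong (rotate^ (length xs)) (++-assoc xs ys [ x ]) ⟩
  rotate^ (length xs) (xs ++ ys ++ [ x ])   ≡⟨ rotate^-++ xs (ys ++ [ x ]) ⟩
  (ys ++ [ x ]) ++ xs                       ≡⟨ ++-assoc ys [ x ] xs ⟩
  ys ++ x ∷ xs                              ∎
  where open ≡-Reasoning

rotate^-length : (xs : List A) → rotate^ (length xs) xs ≡ xs
rotate^-length xs = trans (cong (rotate^ (length xs)) (sym (++-identityʳ xs))) (rotate^-++ xs [])

rotate^-suc-pred-length : (xs : List A) → rotate^ (suc (pred (length xs))) xs ≡ xs
rotate^-suc-pred-length []         = refl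
rotate^-suc-pred-length xs@(_ ∷ _) = rotate^-length xs

replicate-∷ʳ : ∀ n (x : A) → replicate n x ++ [ x ] ≡ x ∷ replicate n x
replicate-∷ʳ zero    x = refl
replicate-∷ʳ (suc n) x = cong (x ∷_) (replicate-∷ʳ n x)

rotate-replicate : ∀ n (x : A) → rotate (replicate n x) ≡ replicate n x
rotate-replicate zero    x = refl
rotate-replicate (suc n) x = replicate-∷ʳ n x

replicate-≢[] : 1 ≤ n → replicate n x ≢ []
replicate-≢[] (s≤s z≤n) ()

∈-replicate : 1 ≤ n → x ∈ replicate n x
∈-replicate (s≤s z≤n) = here refl

_↝_ : List A → List A → Set
xs ↝ ys = ∃[ c ] ys ≡ drop 1 xs ++ [ c ]

↝-rotate : xs ≢ [] → xs ↝ rotate xs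
↝-rotate {xs = []}    xs≢[] = contradiction refl xs≢[]
↝-rotate {xs = x ∷ _} _     = x , refl

↝-same-tail : drop 1 xs ≡ drop 1 ys → xs ↝ zs → ys ↝ zs
↝-same-tail same (c , refl) = c , cong (_++ [ c ]) same

-- Closed walks

Linked-retarget : (∀ {y} → R x y → R e y) → Linked R (x ∷ ys) → Linked R (e ∷ ys)
Linked-retarget x⇒e [-]      = [-]
Linked-retarget x⇒e (r ∷ rs) = x⇒e r ∷ rs

Linked-splice : Linked R (x ∷ zs ++ [ e ]) → Linked R (e ∷ ys) → Linked R (x ∷ zs ++ e ∷ ys)
Linked-splice {zs = []}    (r ∷ [-]) rs′ = r ∷ rs′
Linked-splice {zs = _ ∷ _} (r ∷ rs)  rs′ = r ∷ Linked-splice rs rs′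

Linked-insert : (∀ {y} → R t y → R e y) → Linked R (xs ++ t ∷ ys) → Linked R (t ∷ zs ++ [ e ]) →
                Linked R (xs ++ t ∷ zs ++ e ∷ ys)
Linked-insert {xs = []}              t⇒e rs       detour = Linked-splice detour (Linked-retarget t⇒e rs)
Linked-insert {xs = _ ∷ []}          t⇒e (r ∷ rs) detour = r ∷ Linked-insert {xs = []} t⇒e rs detour
Linked-insert {xs = _ ∷ xs@(_ ∷ _)} t⇒e (r ∷ rs) detour = r ∷ Linked-insert {xs = xs} t⇒e rs detour

Closed : (A → A → Set) → List A → Set
Closed R xs = Linked R (xs ++ take 1 xs)

take-1-++-∷ : (xs ys : List A) → take 1 (xs ++ t ∷ ys) ≡ take 1 (xs ++ [ t ])
take-1-++-∷ []      _ = refl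
take-1-++-∷ (_ ∷ _) _ = refl

Closed-insert : (∀ {y} → R t y → R e y) → Closed R (xs ++ t ∷ ys) → Linked R (t ∷ zs ++ [ e ]) →
                Closed R (xs ++ t ∷ zs ++ e ∷ ys)
Closed-insert {R = R} {t} {e} {xs} {ys} {zs} t⇒e closed detour =
  subst (Linked R) (sym reassociate)
    (Linked-insert {xs = xs} t⇒e (subst (Linked R) (++-assoc xs (t ∷ ys) _) closed) detour)
  where
  open ≡-Reasoning
  reassociate : (xs ++ t ∷ zs ++ e ∷ ys) ++ take 1 (xs ++ t ∷ zs ++ e ∷ ys) ≡
                xs ++ t ∷ zs ++ e ∷ ys ++ take 1 (xs ++ t ∷ ys)
  reassociate = begin
    (xs ++ t ∷ zs ++ e ∷ ys) ++ take 1 (xs ++ t ∷ zs ++ e ∷ ys)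
      ≡⟨ cong ((xs ++ t ∷ zs ++ e ∷ ys) ++_) (trans (take-1-++-∷ xs _) (sym (take-1-++-∷ xs ys))) ⟩
    (xs ++ t ∷ zs ++ e ∷ ys) ++ take 1 (xs ++ t ∷ ys)
      ≡⟨ ++-assoc xs _ _ ⟩
    xs ++ t ∷ (zs ++ e ∷ ys) ++ take 1 (xs ++ t ∷ ys)
      ≡⟨ cong (λ ws → xs ++ t ∷ ws) (++-assoc zs (e ∷ ys) _) ⟩
    xs ++ t ∷ zs ++ e ∷ ys ++ take 1 (xs ++ t ∷ ys)
      ∎

detour-↭ : ∀ xs (t : A) zs e ys → xs ++ t ∷ zs ++ e ∷ ys ↭ (zs ++ [ e ]) ++ xs ++ t ∷ ys
detour-↭ xs t zs e ys = begin
  xs ++ t ∷ zs ++ e ∷ ys                ≡⟨ ++-assoc xs [ t ] _ ⟨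
  (xs ++ [ t ]) ++ zs ++ e ∷ ys         ≡⟨ cong ((xs ++ [ t ]) ++_) (++-assoc zs [ e ] ys) ⟨
  (xs ++ [ t ]) ++ (zs ++ [ e ]) ++ ys  ↭⟨ shifts (xs ++ [ t ]) (zs ++ [ e ]) ⟩
  (zs ++ [ e ]) ++ (xs ++ [ t ]) ++ ys  ≡⟨ cong ((zs ++ [ e ]) ++_) (++-assoc xs [ t ] ys) ⟩
  (zs ++ [ e ]) ++ xs ++ t ∷ ys         ∎
  where open PermutationReasoning

Unique-resp-↭ : {xs ys : List A} → xs ↭ ys → Unique xs → Unique ys
Unique-resp-↭ {A = A} xs↭ys = Permutationₛ.Unique-resp-↭ (setoid A) (↭⇒↭ₛ xs↭ys)

least-witness : (P : ℕ → Set) → Decidable P → P k → ∃[ d ] (P d × ∀ i → i < d → ¬ P i)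
least-witness {zero}  P P? p = 0 , p , λ _ ()
least-witness {suc k} P P? p with P? 0
... | yes p₀ = 0 , p₀ , λ _ ()
... | no ¬p₀ with d , pd , below ← least-witness (P ∘ suc) (P? ∘ suc) p =
  suc d , pd , λ { zero _ → ¬p₀ ; (suc i) i<d → below i (s≤s⁻¹ i<d) }

-- orbit = rotate¹ xs ∷ … ∷ rotate^(d+1) xs, where d + 1 is the least period
-- of xs under rotation; so it ends with xs itself and has no repetitions.
module Orbit (_≟ᴬ_ : DecidableEquality A) (xs : List A) where

  private
    minimal-turn : ∃[ d ] (rotate^ (suc d) xs ≡ xs × ∀ i → i < d → rotate^ (suc i) xs ≢ xs)
    minimal-turn = least-witness {pred (length xs)} _
      (λ d → ≡-dec _≟ᴬ_ (rotate^ (suc d) xs) xs) (rotate^-suc-pred-length xs)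

    d : ℕ
    d = proj₁ minimal-turn

    turn : rotate^ (suc d) xs ≡ xs
    turn = proj₁ (proj₂ minimal-turn)

    step : ℕ → List A
    step i = rotate^ (suc i) xs

  orbit : List (List A)
  orbit = applyUpTo step (suc d)

  private
    ∈-orbit⁻ : ys ∈ orbit → ∃[ i ] (i ≤ d × ys ≡ step i)
    ∈-orbit⁻ ys∈ with i , i<1+d , eq ← ∈-applyUpTo⁻ step ys∈ = i , s≤s⁻¹ i<1+d , eq

    rotate-step-∈-orbit : i ≤ d → rotate (step i) ∈ orbit
    rotate-step-∈-orbit {i} i≤d with m≤n⇒m<n∨m≡n i≤d
    ... | inj₁ i<d  = subst (_∈ orbit) (rotate^-suc (suc i) xs) (∈-applyUpTo⁺ step (s≤s i<d))
    ... | inj₂ refl = subst (_∈ orbit) (cong rotate (sym turn)) (∈-applyUpTo⁺ step (s≤s z≤n))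

  orbit-ends : ∃[ zs ] orbit ≡ zs ++ [ xs ]
  orbit-ends = applyUpTo step d ,
    trans (sym (applyUpTo-∷ʳ step d)) (cong (λ z → applyUpTo step d ++ [ z ]) turn)

  All-orbit : {P : List A → Set} → (∀ k → P (rotate^ k xs)) → All P orbit
  All-orbit P-rotate = Allₚ.applyUpTo⁺₂ step (suc d) (P-rotate ∘ suc)

  rotate-∈-orbit : ys ∈ orbit → rotate ys ∈ orbit
  rotate-∈-orbit ys∈ with i , i≤d , refl ← ∈-orbit⁻ ys∈ = rotate-step-∈-orbit i≤d

  orbit-returns : ys ∈ orbit → ∃[ k ] rotate^ k ys ≡ xs
  orbit-returns ys∈ with i , i≤d , refl ← ∈-orbit⁻ ys∈ = d ∸ i , (begin
    rotate^ (d ∸ i) (rotate^ (suc i) xs) ≡⟨ rotate^-+ (suc i) (d ∸ i) xs ⟨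
    rotate^ (suc i + (d ∸ i)) xs         ≡⟨ cong (λ k → rotate^ (suc k) xs) (m+[n∸m]≡n i≤d) ⟩
    rotate^ (suc d) xs                   ≡⟨ turn ⟩
    xs                                   ∎)
    where open ≡-Reasoning

  orbit-unique : Unique orbit
  orbit-unique = Uniqueₚ.applyUpTo⁺₁ step (suc d) distinct
    where
    distinct : i < j → j < suc d → step i ≢ step j
    distinct {i} i<j j<1+d eq with o , refl ← m≤n⇒∃[o]m+o≡n i<j =
      proj₂ (proj₂ minimal-turn) o (≤-trans (s≤s (m≤n+m o i)) (s≤s⁻¹ j<1+d)) (sym returns)
      where
      open ≡-Reasoning
      returns : xs ≡ rotate^ (suc o) xs
      returns = rotate^-injective (suc i) (begin
        rotate^ (suc i) xs                    ≡⟨ eq ⟩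
        rotate^ (suc (suc i + o)) xs          ≡⟨ cong (λ l → rotate^ (suc (suc l)) xs) (+-comm i o) ⟩
        rotate^ (suc (suc o + i)) xs          ≡⟨ cong (λ l → rotate^ l xs) (+-suc (suc o) i) ⟨
        rotate^ (suc o + suc i) xs            ≡⟨ rotate^-+ (suc o) (suc i) xs ⟩
        rotate^ (suc i) (rotate^ (suc o) xs)  ∎)

  orbit-linked : xs ≢ [] → Linked _↝_ (xs ∷ orbit)
  orbit-linked xs≢[] = Linkedₚ.applyUpTo⁺₂ (λ i → rotate^ i xs) (suc (suc d)) λ i →
    subst (rotate^ i xs ↝_) (sym (rotate^-suc i xs)) (↝-rotate (rotate^-≢[] i xs≢[]))

-- Patterns

Word : Set
Word = List ℕ

letters : ℕ → List ℕ
letters m = applyUpTo suc m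

∈-letters : ∀ {x} → InAlphabet m x → x ∈ letters m
∈-letters {x = suc i} (_ , i<m) = ∈-applyUpTo⁺ suc i<m

words : List A → ℕ → List (List A)
words xs zero    = [ [] ]
words xs (suc n) = cartesianProductWith _∷_ xs (words xs n)

∈-words : All (_∈ xs) ys → ys ∈ words xs (length ys)
∈-words []       = here refl
∈-words (p ∷ ps) = ∈-cartesianProductWith⁺ _∷_ p (∈-words ps)

-- IsPattern w unfolds to w ≢ [] × ∃[ k ] Spans k w.
Spans : ℕ → Word → Set
Spans k w = 1 ≤ k × All (λ x → 1 ≤ x × x ≤ k) w × (∀ x → 1 ≤ x → x ≤ k → x ∈ w)

Spans-resp-↭ : ∀ {v w} → v ↭ w → Spans k v → Spans k w
Spans-resp-↭ v↭w (1≤k , bounded , covers) =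
  1≤k , All-resp-↭ v↭w bounded , λ x 1≤x x≤k → ∈-resp-↭ v↭w (covers x 1≤x x≤k)

PatternOver-resp-↭ : ∀ {v w} → v ↭ w → PatternOver m n v → PatternOver m n w
PatternOver-resp-↭ v↭w (len , alphabet , v≢[] , k , spans) =
  trans (sym (↭-length v↭w)) len ,
  All-resp-↭ v↭w alphabet ,
  (λ w≡[] → v≢[] (↭-empty-inv (subst (_ ↭_) w≡[] v↭w))) ,
  k , Spans-resp-↭ v↭w spans

covers? : ∀ k w → Dec (∀ x → 1 ≤ x → x ≤ k → x ∈ w)
covers? k w = map′ from to (all? (λ x → any? (x ≟_) w) (letters k))
  where
  from : All (_∈ w) (letters k) → ∀ x → 1 ≤ x → x ≤ k → x ∈ w
  from all (suc i) _ i<k = All.lookup all (∈-applyUpTo⁺ suc i<k)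
  to : (∀ x → 1 ≤ x → x ≤ k → x ∈ w) → All (_∈ w) (letters k)
  to covers = Allₚ.applyUpTo⁺₁ suc k λ i<k → covers _ (s≤s z≤n) i<k

spans? : ∀ k w → Dec (Spans k w)
spans? k w = (1 ≤? k) ×-dec all? (λ x → (1 ≤? x) ×-dec (x ≤? k)) w ×-dec covers? k w

-- A spanning k occurs in w, so only the letters of w need to be tried.
isPattern? : ∀ w → Dec (IsPattern w)
isPattern? []        = no λ (w≢[] , _) → w≢[] refl
isPattern? w@(_ ∷ _) = map′ (λ found → (λ ()) , satisfied found)
  (λ (_ , k , spans@(1≤k , _ , covers)) → lose (covers k 1≤k ≤-refl) spans)
  (any? (λ k → spans? k w) w)

patternOver? : ∀ m n w → Dec (PatternOver m n w)
patternOver? m n w = (length w ≟ n) ×-dec all? (λ x → (1 ≤? x) ×-dec (x ≤? m)) w ×-dec isPattern? w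

Spans-lower : ∀ {k xs} → 2 ≤ k → Spans k (k ∷ xs) → ∃[ j ] Spans j (1 ∷ xs)
Spans-lower {suc (suc k)} {xs} (s≤s (s≤s z≤n)) (1≤k , _ ∷ bounded , covers)
  with any? (suc (suc k) ≟_) xs
... | yes k∈xs =
  suc (suc k) , 1≤k , (≤-refl , 1≤k) ∷ bounded , λ x 1≤x x≤k → there (other (covers x 1≤x x≤k))
  where
  other : ∀ {x} → x ∈ suc (suc k) ∷ xs → x ∈ xs
  other (here refl)  = k∈xs
  other (there x∈xs) = x∈xs
... | no k∉xs = suc k , s≤s z≤n , (≤-refl , s≤s z≤n) ∷ All.tabulate below , covers′
  where
  below : ∀ {y} → y ∈ xs → 1 ≤ y × y ≤ suc k
  below {y} y∈xs with 1≤y , y≤k ← All.lookup bounded y∈xs =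
    1≤y , s≤s⁻¹ (≤∧≢⇒< y≤k λ y≡k → k∉xs (subst (_∈ xs) y≡k y∈xs))
  covers′ : ∀ x → 1 ≤ x → x ≤ suc k → x ∈ 1 ∷ xs
  covers′ x 1≤x x≤k with covers x 1≤x (m≤n⇒m≤1+n x≤k)
  ... | here refl  = contradiction x≤k 1+n≰n
  ... | there x∈xs = there x∈xs

lower-pattern : ∀ {xs} → 1 ≤ m → 2 ≤ k → Spans k (k ∷ xs) → PatternOver m n (k ∷ xs) →
                PatternOver m n (1 ∷ xs)
lower-pattern 1≤m 2≤k spans (len , _ ∷ alphabet , _) =
  len , (≤-refl , 1≤m) ∷ alphabet , (λ ()) , Spans-lower 2≤k spans

all-one : ∀ {w} → All (λ x → 1 ≤ x × x ≤ 1) w → w ≡ replicate (length w) 1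
all-one []                              = refl
all-one ((s≤s z≤n , s≤s z≤n) ∷ bounded) = cong (1 ∷_) (all-one bounded)

lead : Word → ℕ
lead []      = 0
lead (x ∷ _) = x

lead-InAlphabet : ∀ {w} → PatternOver m n w → InAlphabet m (lead w)
lead-InAlphabet {w = []}    (_ , _ , w≢[] , _) = contradiction refl w≢[]
lead-InAlphabet {w = _ ∷ _} (_ , x∈ ∷ _ , _)   = x∈

-- Joining rotation classes into one cycle

module _ (_≟ᴬ_ : DecidableEquality A) where
  open DecMembership _≟ᴬ_ using (_∈?_)

  missing : List A → List A → ℕ
  missing T []      = 0
  missing T (x ∷ E) with x ∈? T
  ... | yes _ = missing T E
  ... | no  _ = suc (missing T E)

  missing-antimono : {T T′ : List A} → T ⊆ T′ → ∀ E → missing T′ E ≤ missing T E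
  missing-antimono T⊆T′ [] = z≤n
  missing-antimono {T} {T′} T⊆T′ (x ∷ E) with x ∈? T′ | x ∈? T
  ... | yes _   | yes _   = missing-antimono T⊆T′ E
  ... | yes _   | no  _   = m≤n⇒m≤1+n (missing-antimono T⊆T′ E)
  ... | no x∉T′ | yes x∈T = contradiction (T⊆T′ x∈T) x∉T′
  ... | no  _   | no  _   = s≤s (missing-antimono T⊆T′ E)

  missing-< : {T T′ E : List A} → T ⊆ T′ → e ∈ E → e ∉ T → e ∈ T′ → missing T′ E < missing T E
  missing-< {T = T} {T′} {x ∷ E} T⊆T′ e∈E e∉T e∈T′ with x ∈? T′ | x ∈? T | e∈E
  ... | _       | yes x∈T | here refl = contradiction x∈T e∉T
  ... | no x∉T′ | _       | here refl = contradiction e∈T′ x∉T′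
  ... | yes _   | no _    | here refl = s≤s (missing-antimono T⊆T′ E)
  ... | no x∉T′ | yes x∈T | there _   = contradiction (T⊆T′ x∈T) x∉T′
  ... | yes _   | yes _   | there e∈  = missing-< T⊆T′ e∈ e∉T e∈T′
  ... | yes _   | no _    | there e∈  = m<n⇒m<1+n (missing-< T⊆T′ e∈ e∉T e∈T′)
  ... | no _    | no _    | there e∈  = s≤s (missing-< T⊆T′ e∈ e∉T e∈T′)

module CycleJoining (m n : ℕ) (1≤m : 1 ≤ m) (1≤n : 1 ≤ n) where

  open DecMembership (≡-dec _≟_) using (_∈?_)

  ones : Word
  ones = replicate n 1

  ones-pattern : PatternOver m n ones
  ones-pattern =
    length-replicate n , Allₚ.replicate⁺ n (≤-refl , 1≤m) , replicate-≢[] 1≤n ,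
    1 , ≤-refl , Allₚ.replicate⁺ n (≤-refl , ≤-refl) ,
    λ { 1 _ _ → ∈-replicate 1≤n ; (suc (suc _)) _ (s≤s ()) }

  record Cycle (T : List Word) : Set where
    field
      closed          : Closed _↝_ T
      unique          : Unique T
      patterns        : All (PatternOver m n) T
      rotation-closed : ∀ {w} → w ∈ T → rotate w ∈ T
      ones-∈          : ones ∈ T

    rotate^-closed : ∀ k {w} → w ∈ T → rotate^ k w ∈ T
    rotate^-closed zero    w∈T = w∈T
    rotate^-closed (suc k) w∈T = rotate^-closed k (rotation-closed w∈T)

  cycle-ones : Cycle [ ones ]
  cycle-ones = record
    { closed          = ones↝ones ∷ [-]
    ; unique          = [] ∷ []
    ; patterns        = ones-pattern ∷ []
    ; rotation-closed = λ { (here refl) → here (rotate-replicate n 1) }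
    ; ones-∈          = here refl
    }
    where
    ones↝ones : ones ↝ ones
    ones↝ones = subst (ones ↝_) (rotate-replicate n 1) (↝-rotate (replicate-≢[] 1≤n))

  join : ∀ {T e t} → Cycle T → PatternOver m n e → e ∉ T → t ∈ T → drop 1 e ≡ drop 1 t →
         ∃[ T′ ] (Cycle T′ × T ⊆ T′ × e ∈ T′)
  join {e = e} {t} C pe@(_ , _ , e≢[] , _) e∉T t∈T same-tail with A , B , refl ← ∈-∃++ t∈T =
    T′ , C′ , ∈-T′ ∘ ∈-++⁺ʳ orbit , ∈-++⁺ʳ A (there (∈-++⁺ʳ path (here refl)))
    where
    open Cycle C
    open Orbit _≟_ e

    path : List Word
    path = proj₁ orbit-ends

    T′ : List Word
    T′ = A ++ t ∷ path ++ e ∷ B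

    T′↭ : T′ ↭ orbit ++ A ++ t ∷ B
    T′↭ = subst (λ O → T′ ↭ O ++ A ++ t ∷ B) (sym (proj₂ orbit-ends)) (detour-↭ A t path e B)

    ∈-T′ : ∀ {w} → w ∈ orbit ++ A ++ t ∷ B → w ∈ T′
    ∈-T′ = ∈-resp-↭ (↭-sym T′↭)

    detour : Linked _↝_ (t ∷ path ++ [ e ])
    detour = subst (Linked _↝_ ∘ (t ∷_)) (proj₂ orbit-ends)
      (Linked-retarget (↝-same-tail {xs = e} {t} same-tail) (orbit-linked e≢[]))

    disjoint : Disjoint orbit (A ++ t ∷ B)
    disjoint (w∈orbit , w∈T) with k , refl ← orbit-returns w∈orbit = e∉T (rotate^-closed k w∈T)

    rotate-∈ : ∀ {w} → w ∈ orbit ++ A ++ t ∷ B → rotate w ∈ orbit ++ A ++ t ∷ B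
    rotate-∈ w∈ with ∈-++⁻ orbit w∈
    ... | inj₁ w∈orbit = ∈-++⁺ˡ (rotate-∈-orbit w∈orbit)
    ... | inj₂ w∈T     = ∈-++⁺ʳ orbit (rotation-closed w∈T)

    C′ : Cycle T′
    C′ = record
      { closed          = Closed-insert {xs = A} (↝-same-tail {xs = t} {e} (sym same-tail)) closed detour
      ; unique          = Unique-resp-↭ (↭-sym T′↭) (Uniqueₚ.++⁺ orbit-unique unique disjoint)
      ; patterns        = All-resp-↭ (↭-sym T′↭) (Allₚ.++⁺ (All-orbit rotated) patterns)
      ; rotation-closed = λ w∈ → ∈-T′ (rotate-∈ (∈-resp-↭ T′↭ w∈))
      ; ones-∈          = ∈-T′ (∈-++⁺ʳ orbit ones-∈)
      }
      where
      rotated : ∀ k → PatternOver m n (rotate^ k e)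
      rotated k = PatternOver-resp-↭ (↭-sym (↭-rotate^ k e)) pe

  Saturated : List Word → Set
  Saturated T = ∀ {e t} → PatternOver m n e → t ∈ T → drop 1 e ≡ drop 1 t → e ∈ T

  candidates : List Word
  candidates = words (letters m) n

  ∈-candidates : ∀ {w} → PatternOver m n w → w ∈ candidates
  ∈-candidates {w} (len , alphabet , _) =
    subst (λ l → w ∈ words (letters m) l) len (∈-words (All.map ∈-letters alphabet))

  saturate : ∀ {T} → Cycle T → Acc _<_ (missing (≡-dec _≟_) T candidates) →
             ∃[ T′ ] (Cycle T′ × Saturated T′)
  saturate {T} C (acc smaller) with any? joinable? candidates
    where
    joinable? : ∀ e → Dec (PatternOver m n e × e ∉ T × Any (λ t → drop 1 e ≡ drop 1 t) T)
    joinable? e = patternOver? m n e ×-dec ¬? (e ∈? T) ×-dec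
                  any? (λ t → ≡-dec _≟_ (drop 1 e) (drop 1 t)) T
  ... | yes found =
    let e , e∈ , pe , e∉T , adjacent = find found
        t , t∈T , same-tail = find adjacent
        T′ , C′ , T⊆T′ , e∈T′ = join C pe e∉T t∈T same-tail
    in saturate C′ (smaller (missing-< (≡-dec _≟_) T⊆T′ e∈ e∉T e∈T′))
  ... | no none = T , C , λ pe t∈T same-tail →
    decidable-stable (_ ∈? T) λ e∉T → none (lose (∈-candidates pe) (pe , e∉T , lose t∈T same-tail))

  saturated-complete : ∀ {T} → Cycle T → Saturated T →
                       ∀ {w} → Acc _<_ (sum w) → PatternOver m n w → w ∈ T
  saturated-complete C sat _ (_ , _ , _ , zero , () , _)
  saturated-complete {T} C sat _ (len , _ , _ , suc zero , _ , bounded , _) =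
    subst (_∈ T) (sym (trans (all-one bounded) (cong (λ l → replicate l 1) len))) (Cycle.ones-∈ C)
  saturated-complete {T} C sat (acc smaller)
                     pw@(_ , _ , _ , k@(suc (suc _)) , spans@(_ , _ , covers))
    with u , v , refl ← ∈-∃++ (covers k (s≤s z≤n) ≤-refl) =
    subst (_∈ T) (rotate^-++ (k ∷ v) u) (Cycle.rotate^-closed C (length (k ∷ v)) k∷vu∈T)
    where
    w↭ : u ++ k ∷ v ↭ k ∷ v ++ u
    w↭ = ++-comm u (k ∷ v)

    pk : PatternOver m n (k ∷ v ++ u)
    pk = PatternOver-resp-↭ w↭ pw

    p1 : PatternOver m n (1 ∷ v ++ u)
    p1 = lower-pattern 1≤m (s≤s (s≤s z≤n)) (Spans-resp-↭ w↭ spans) pk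

    smaller-sum : sum (1 ∷ v ++ u) < sum (u ++ k ∷ v)
    smaller-sum = subst (sum (1 ∷ v ++ u) <_) (sym (sum-↭ w↭))
                    (+-monoˡ-< (sum (v ++ u)) (s≤s (s≤s z≤n)))

    k∷vu∈T : k ∷ v ++ u ∈ T
    k∷vu∈T = sat pk (saturated-complete C sat (smaller smaller-sum) p1) refl

  hamiltonian-cycle : ∃[ T ] (Cycle T × ∀ {w} → PatternOver m n w → w ∈ T)
  hamiltonian-cycle =
    let T , C , sat = saturate cycle-ones (<-wellFounded _)
    in T , C , saturated-complete C sat (<-wellFounded _)

-- Reading off the universal cycle

take-++ˡ : ∀ (xs : List A) {ys} → j ≤ length xs → take j (xs ++ ys) ≡ take j xs
take-++ˡ {j = zero}  xs       _         = refl
take-++ˡ {j = suc j} (x ∷ xs) (s≤s j≤n) = cong (x ∷_) (take-++ˡ xs j≤n)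

↝-take : ∀ {v w : Word} → v ↝ w → j < length v → take (suc j) v ≡ lead v ∷ take j w
↝-take {v = x ∷ xs} (c , refl) (s≤s j≤n) = cong (x ∷_) (sym (take-++ˡ xs j≤n))

take-spelled : (f : ℕ → Word) → (∀ k → length (f k) ≡ n) → (∀ k → f k ↝ f (suc k)) →
               j ≤ n → take j (f 0) ≡ applyUpTo (lead ∘ f) j
take-spelled {j = zero}  f _   _    _   = refl
take-spelled {j = suc j} f len link j<n =
  trans (↝-take (link 0) (subst (j <_) (sym (len 0)) j<n))
        (cong (lead (f 0) ∷_) (take-spelled (f ∘ suc) (len ∘ suc) (link ∘ suc) (<⇒≤ j<n)))

spelled : (f : ℕ → Word) → (∀ k → length (f k) ≡ n) → (∀ k → f k ↝ f (suc k)) →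
          f 0 ≡ map (lead ∘ f) (upTo n)
spelled {n} f len link = begin
  f 0                     ≡⟨ take-all n (f 0) (≤-reflexive (len 0)) ⟨
  take n (f 0)            ≡⟨ take-spelled f len link ≤-refl ⟩
  applyUpTo (lead ∘ f) n  ≡⟨ map-upTo (lead ∘ f) n ⟨
  map (lead ∘ f) (upTo n) ∎
  where open ≡-Reasoning

_!_ : List Word → ℕ → Word
[]       ! _     = []
(w ∷ ws) ! zero  = w
(w ∷ ws) ! suc i = ws ! i

!-∈ : ∀ ws → i < length ws → ws ! i ∈ ws
!-∈ {zero}  (w ∷ ws) _         = here refl
!-∈ {suc i} (w ∷ ws) (s≤s i<n) = there (!-∈ ws i<n)

∈⇒! : ∀ {w ws} → w ∈ ws → ∃[ i ] (i < length ws × ws ! i ≡ w)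
∈⇒! (here refl) = 0 , s≤s z≤n , refl
∈⇒! (there w∈)  with i , i<n , eq ← ∈⇒! w∈ = suc i , s≤s i<n , eq

!-injective : ∀ {ws} → Unique ws → i < length ws → j < length ws → ws ! i ≡ ws ! j → i ≡ j
!-injective {zero}  {zero}  {w ∷ ws} _        _         _         _  = refl
!-injective {zero}  {suc j} {w ∷ ws} (w∉ ∷ _) _         (s≤s j<n) eq =
  contradiction eq (All.lookup w∉ (!-∈ ws j<n))
!-injective {suc i} {zero}  {w ∷ ws} (w∉ ∷ _) (s≤s i<n) _         eq =
  contradiction (sym eq) (All.lookup w∉ (!-∈ ws i<n))
!-injective {suc i} {suc j} {w ∷ ws} (_ ∷ u)  (s≤s i<n) (s≤s j<n) eq =
  cong suc (!-injective u i<n j<n eq)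

!-++ˡ : ∀ ws {vs} → i < length ws → (ws ++ vs) ! i ≡ ws ! i
!-++ˡ {zero}  (w ∷ ws) _         = refl
!-++ˡ {suc i} (w ∷ ws) (s≤s i<n) = !-++ˡ ws i<n

!-++-length : ∀ ws {v vs} → (ws ++ v ∷ vs) ! length ws ≡ v
!-++-length []       = refl
!-++-length (w ∷ ws) = !-++-length ws

Linked-!-∷ʳ : ∀ {R : Word → Word → Set} {ws v} → Linked R (ws ++ [ v ]) → i < length ws →
              R (ws ! i) ((ws ++ [ v ]) ! suc i)
Linked-!-∷ʳ {zero}  {ws = _ ∷ []}             (r ∷ _)  _         = r
Linked-!-∷ʳ {zero}  {ws = _ ∷ _ ∷ _}          (r ∷ _)  _         = r
Linked-!-∷ʳ {suc i} {ws = _ ∷ ws@(_ ∷ _)} (_ ∷ rs) (s≤s i<n) = Linked-!-∷ʳ {ws = ws} rs i<n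

suc-% : ∀ k N .{{_ : NonZero N}} → suc k % N ≡ suc (k % N) % N
suc-% k N = begin
  suc k % N                      ≡⟨ cong (λ l → suc l % N) (m≡m%n+[m/n]*n k N) ⟩
  (suc (k % N) + k / N * N) % N  ≡⟨ [m+kn]%n≡m%n (suc (k % N)) (k / N) N ⟩
  suc (k % N) % N                ∎
  where open ≡-Reasoning

module _ {L : ℕ} where

  private
    N : ℕ
    N = suc L

  suc-%-inverse : i < N → (suc i % N + L) % N ≡ i
  suc-%-inverse {i} (s≤s i≤L) = begin
    (suc i % N + L) % N      ≡⟨ cong (λ l → (suc i % N + l) % N) (m≤n⇒m%n≡m ≤-refl) ⟨
    (suc i % N + L % N) % N  ≡⟨ %-distribˡ-+ (suc i) L N ⟨
    (suc i + L) % N          ≡⟨ cong (_% N) (+-suc i L) ⟨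
    (i + N) % N              ≡⟨ [m+n]%n≡m%n i N ⟩
    i % N                    ≡⟨ m≤n⇒m%n≡m i≤L ⟩
    i                        ∎
    where open ≡-Reasoning

  suc-%-injective : i < N → j < N → suc i % N ≡ suc j % N → i ≡ j
  suc-%-injective i<N j<N eq =
    trans (sym (suc-%-inverse i<N)) (trans (cong (λ r → (r + L) % N) eq) (suc-%-inverse j<N))

  suc-%-surjective : ∀ {p} → p < N → ∃[ i ] (i < N × suc i % N ≡ p)
  suc-%-surjective {zero}  _         = L , ≤-refl , n%n≡0 N
  suc-%-surjective {suc p} (s≤s p<L) = p , m<n⇒m<1+n p<L , m≤n⇒m%n≡m p<L

module UniversalCycle {n : ℕ} (t₀ : Word) (ts : List Word)
  (closed : Closed _↝_ (t₀ ∷ ts)) (lengths : All (λ w → length w ≡ n) (t₀ ∷ ts)) where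

  T : List Word
  T = t₀ ∷ ts

  N : ℕ
  N = suc (length ts)

  cyc : ℕ → Word
  cyc k = T ! (k % N)

  letter : ℕ → ℕ
  letter k = lead (cyc k)

  cyc-∈ : ∀ k → cyc k ∈ T
  cyc-∈ k = !-∈ T (m%n<n k N)

  private
    wraps : ∀ {r} → r < N → (T ++ [ t₀ ]) ! suc r ≡ T ! (suc r % N)
    wraps (s≤s r≤L) with m≤n⇒m<n∨m≡n r≤L
    ... | inj₁ r<L  = trans (!-++ˡ ts r<L) (cong (T !_) (sym (m≤n⇒m%n≡m r<L)))
    ... | inj₂ refl = trans (!-++-length ts) (cong (T !_) (sym (n%n≡0 N)))

  cyc-↝ : ∀ k → cyc k ↝ cyc (suc k)
  cyc-↝ k = subst (cyc k ↝_) (trans (wraps r<N) (cong (T !_) (sym (suc-% k N)))) (Linked-!-∷ʳ closed r<N)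
    where
    r<N : k % N < N
    r<N = m%n<n k N

  window-cyc : ∀ i → window N letter n i ≡ cyc (suc i)
  window-cyc i = begin
    map (λ j → letter ((i + 1 + j) % N)) (upTo n)  ≡⟨ map-cong reindex (upTo n) ⟩
    map (λ j → lead (cyc (j + suc i))) (upTo n)    ≡⟨ spelled shifted length-shifted (cyc-↝ ∘ (_+ suc i)) ⟨
    cyc (suc i)                                    ∎
    where
    open ≡-Reasoning
    shifted : ℕ → Word
    shifted j = cyc (j + suc i)

    reindex : ∀ j → letter ((i + 1 + j) % N) ≡ lead (shifted j)
    reindex j = cong (λ l → lead (T ! l)) (trans (m%n%n≡m%n (i + 1 + j) N)
                  (cong (_% N) (trans (+-comm (i + 1) j) (cong (j +_) (+-comm i 1)))))

    length-shifted : ∀ j → length (shifted j) ≡ n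
    length-shifted j = All.lookup lengths (cyc-∈ (j + suc i))

  window-injective : Unique T → i < N → j < N → window N letter n i ≡ window N letter n j → i ≡ j
  window-injective {i} {j} unique i<N j<N eq = suc-%-injective i<N j<N
    (!-injective unique (m%n<n (suc i) N) (m%n<n (suc j) N)
      (trans (sym (window-cyc i)) (trans eq (window-cyc j))))

  window-surjective : ∀ {w} → w ∈ T → ∃[ i ] (i < N × window N letter n i ≡ w)
  window-surjective w∈T =
    let p , p<N , Tp≡w = ∈⇒! w∈T
        i , i<N , i↦p  = suc-%-surjective p<N
    in i , i<N , trans (window-cyc i) (trans (cong (T !_) i↦p) Tp≡w)

corollary1 : (m n : ℕ) → 1 ≤ m → 1 ≤ n →
    ∃[ N ] Σ (NonZero N) λ nz → ∃[ a ]
      ((∀ i → i < N → InAlphabet m (a i)) ×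
       (∀ i → i < N → PatternOver m n (window N {{nz}} a n i)) ×
       (∀ i j → i < N → j < N → window N {{nz}} a n i ≡ window N {{nz}} a n j → i ≡ j) ×
       (∀ (w : List ℕ) → PatternOver m n w → ∃[ i ] (i < N × window N {{nz}} a n i ≡ w)))
corollary1 m n 1≤m 1≤n with CycleJoining.hamiltonian-cycle m n 1≤m 1≤n
... | [] , C , _ = contradiction (CycleJoining.Cycle.ones-∈ C) λ ()
... | t₀ ∷ ts , C , complete =
  N , _ , letter ,
  (λ i _ → lead-InAlphabet (All.lookup patterns (cyc-∈ i))) ,
  (λ i _ → subst (PatternOver m n) (sym (window-cyc i)) (All.lookup patterns (cyc-∈ (suc i)))) ,
  (λ i j → window-injective unique) ,
  (λ w → window-surjective ∘ complete)
  where
  open CycleJoining.Cycle C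
  open UniversalCycle t₀ ts closed (All.map proj₁ patterns)
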